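{- For all integers $\Delta\geq 4$ and $k\geq 2$, there is a $3$-colourable graph with $3\lfloor\frac{\Delta}{4}\rfloor^k$ vertices, maximum degree at most $\Delta$, and diameter at most $k$. Moreover, if $k\geq 4$ then there is a $3$-colourable triangle-free graph with $5\lfloor\frac{\Delta}{4}\rfloor^k$ vertices, maximum degree at most $\Delta$, and diameter at most $k$. -}

module Defs where

open import Data.Nat using (ℕ; zero; suc; _≤_; _^_; _*_)
open import Data.Nat.DivMod using (_/_)
open import Data.Fin using (Fin)
open import Data.Bool using (Bool; true; false)
open import Data.List using (List; length; filter; allFin)
open import Data.Product using (Σ; _×_; ∃-syntax)
open import Relation.Binary.PropositionalEquality using (_≡_; _≢_)
open import Relation.Nullary using (¬_)
open import Data.Bool.Properties using (_≟_)

record Graph (n : ℕ) : Set where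
  field
    adj   : Fin n → Fin n → Bool
    sym   : ∀ i j → adj i j ≡ adj j i
    irrefl : ∀ i → adj i i ≡ false
open Graph public

Adj : ∀ {n} → Graph n → Fin n → Fin n → Set
Adj G i j = adj G i j ≡ true

degree : ∀ {n} → Graph n → Fin n → ℕ
degree {n} G i = length (filter (λ j → adj G i j ≟ true) (allFin n))

MaxDegreeAtMost : ∀ {n} → Graph n → ℕ → Set
MaxDegreeAtMost G Δ = ∀ i → degree G i ≤ Δ

data Walk {n : ℕ} (G : Graph n) : Fin n → Fin n → ℕ → Set where
  here : ∀ {u} → Walk G u u zero
  step : ∀ {u w v ℓ} → Adj G u w → Walk G w v ℓ → Walk G u v (suc ℓ)

DistAtMost : ∀ {n} → Graph n → Fin n → Fin n → ℕ → Set
DistAtMost G u v k = ∃[ ℓ ] (ℓ ≤ k × Walk G u v ℓ)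

DiameterAtMost : ∀ {n} → Graph n → ℕ → Set
DiameterAtMost {n} G k = ∀ (u v : Fin n) → DistAtMost G u v k

ThreeColourable : ∀ {n} → Graph n → Set
ThreeColourable {n} G =
  Σ (Fin n → Fin 3) λ c → ∀ i j → Adj G i j → c i ≢ c j

TriangleFree : ∀ {n} → Graph n → Set
TriangleFree {n} G =
  ∀ (a b c : Fin n) → ¬ (Adj G a b × Adj G b c × Adj G a c)

-- Take a small "base" graph H with maximum degree 2 and an alphabet of
-- d = ⌊Δ/4⌋ letters, and form the graph on pairs (c , w) of a vertex of H and
-- a word of length k, where (c , w) ~ (c' , w') when c ~ c' in H and one word
-- is obtained from the other by dropping its first letter and appending a new
-- one (a de Bruijn step).  Each vertex has at most 2 · 2d ≤ Δ neighbours, and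
-- projecting to H is a homomorphism, so colourings and triangle-freeness of H
-- lift.  If any two vertices of H are joined by a walk of length exactly k,
-- then from (c , w) one reaches (c' , v) in k steps by following such a walk
-- while shifting in the letters of v one at a time.  Taking H = K₃ (walks of
-- every length ≥ 2) and H = C₅ (triangle-free, walks of every length ≥ 4)
-- gives the two graphs.
module Submission where

open import Defs hiding (sym)
open import Data.Bool using (Bool; true; false; _∧_; _∨_; not)
open import Data.Bool.Properties using (∨-comm) renaming (_≟_ to _≟ᵇ_)
open import Data.Fin using (Fin; zero; suc; toℕ; combine; funToFin; finToFun)
open import Data.Fin.Properties
  using (all?; any?; *↔×; funToFin-finToFin; finToFun-funToFin)
  renaming (_≟_ to _≟ᶠ_)
open import Data.List
  using (List; []; _∷_; [_]; _++_; length; map; filter; allFin; cartesianProductWith)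
open import Data.List.Properties
  using (length-++; length-map; length-tabulate; length-removeAt′; ++-assoc; ++-identityʳ; ∷-injectiveʳ)
open import Data.List.Membership.Propositional using (_∈_)
open import Data.List.Membership.Propositional.Properties
  using (∈-allFin; ∈-map⁺; ∈-++⁺ˡ; ∈-++⁺ʳ; ∈-filter⁺; ∈-filter⁻; ∈-cartesianProductWith⁺)
open import Data.List.Relation.Binary.Subset.Propositional using (_⊆_)
open import Data.List.Relation.Unary.All as All using ()
open import Data.List.Relation.Unary.Any using (here; there; index; _─_)
open import Data.List.Relation.Unary.AllPairs using ([]; _∷_)
open import Data.List.Relation.Unary.Unique.Propositional using (Unique)
open import Data.List.Relation.Unary.Unique.Propositional.Properties using (allFin⁺; filter⁺)
open import Data.Nat using (ℕ; zero; suc; _≤_; _≤′_; ≤′-refl; ≤′-step; _^_; _*_; _+_; z≤n; s≤s; _≤?_)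
open import Data.Nat.DivMod using (_/_; _%_; m/n*n≤m)
open import Data.Nat.Properties
  using (≤-refl; ≤-trans; ≤-reflexive; module ≤-Reasoning; ≤⇒≤′; suc-injective; *-monoˡ-≤)
  renaming (_≟_ to _≟ℕ_)
open import Data.Nat.Tactic.RingSolver using (solve-∀)
open import Data.Product using (Σ; ∃-syntax; _×_; _,_; proj₁; proj₂; curry)
open import Data.Product.Function.NonDependent.Propositional using (_×-↔_)
open import Data.Sum using (_⊎_; inj₁; inj₂)
open import Data.Vec using (Vec; []; _∷_; _∷ʳ_; init; lookup; tabulate; toList)
open import Data.Vec.Properties
  using (≡-dec; init-∷ʳ; toList-∷ʳ; toList-injective; length-toList; cast-is-id; lookup∘tabulate; tabulate∘lookup; tabulate-cong)
open import Function using (_∘_; _↔_; Inverse; mk↔ₛ′; mk⇔)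
open import Function.Properties.Inverse using (↔-refl; ↔-sym; ↔-trans)
open import Relation.Binary.PropositionalEquality
  using (_≡_; _≢_; refl; sym; trans; cong; cong₂; subst; subst₂; ≢-sym; module ≡-Reasoning)
open import Relation.Nullary using (Dec; yes; no; does; ¬?; contradiction)
open import Relation.Nullary.Decidable using (map′; from-yes; dec-true; does-⇔; _×-dec_; _→-dec_)

private
  variable
    A : Set
    n k ℓ : ℕ

does⇒ : (a? : Dec A) → does a? ≡ true → A
does⇒ (yes a) _ = a

∧-true⁻ : ∀ {a b} → a ∧ b ≡ true → a ≡ true × b ≡ true
∧-true⁻ {true} b≡true = refl , b≡true

∨-true⁻ : ∀ {a b} → a ∨ b ≡ true → a ≡ true ⊎ b ≡ true
∨-true⁻ {true} _ = inj₁ refl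
∨-true⁻ {false} b≡true = inj₂ b≡true

∈-─⁺ : ∀ {x z : A} {ys} (x∈ys : x ∈ ys) → z ∈ ys → z ≢ x → z ∈ (ys ─ x∈ys)
∈-─⁺ (here refl) (here refl) z≢x = contradiction refl z≢x
∈-─⁺ (here refl) (there z∈ys) _ = z∈ys
∈-─⁺ (there _) (here refl) _ = here refl
∈-─⁺ (there x∈ys) (there z∈ys) z≢x = there (∈-─⁺ x∈ys z∈ys z≢x)

Unique-⊆⇒length≤ : {xs ys : List A} → Unique xs → xs ⊆ ys → length xs ≤ length ys
Unique-⊆⇒length≤ {xs = []} _ _ = z≤n
Unique-⊆⇒length≤ {xs = x ∷ xs} {ys} (x∉xs ∷ unique) xs⊆ys =
  ≤-trans (s≤s (Unique-⊆⇒length≤ unique xs⊆ys─x))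
          (≤-reflexive (sym (length-removeAt′ ys (index x∈ys))))
  where
  x∈ys : x ∈ ys
  x∈ys = xs⊆ys (here refl)
  xs⊆ys─x : xs ⊆ (ys ─ x∈ys)
  xs⊆ys─x z∈xs = ∈-─⁺ x∈ys (xs⊆ys (there z∈xs)) (≢-sym (All.lookup x∉xs z∈xs))

length-cartesianProductWith : ∀ {B C : Set} (f : A → B → C) xs ys →
  length (cartesianProductWith f xs ys) ≡ length xs * length ys
length-cartesianProductWith f [] ys = refl
length-cartesianProductWith f (x ∷ xs) ys = begin
  length (map (f x) ys ++ cartesianProductWith f xs ys)
    ≡⟨ length-++ (map (f x) ys) ⟩
  length (map (f x) ys) + length (cartesianProductWith f xs ys)
    ≡⟨ cong₂ _+_ (length-map (f x) ys) (length-cartesianProductWith f xs ys) ⟩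
  length ys + length xs * length ys ∎
  where open ≡-Reasoning

neighbours : Graph n → Fin n → List (Fin n)
neighbours {n} G i = filter (λ j → adj G i j ≟ᵇ true) (allFin n)

∈-neighbours⁺ : (G : Graph n) {i j : Fin n} → Adj G i j → j ∈ neighbours G i
∈-neighbours⁺ G {j = j} = ∈-filter⁺ (λ j → adj G _ j ≟ᵇ true) (∈-allFin j)

degree≤length : (G : Graph n) (i : Fin n) {ys : List (Fin n)} →
  (∀ {j} → Adj G i j → j ∈ ys) → degree G i ≤ length ys
degree≤length {n} G i adj⇒∈ = Unique-⊆⇒length≤
  (filter⁺ (λ j → adj G i j ≟ᵇ true) (allFin⁺ n))
  (adj⇒∈ ∘ proj₂ ∘ ∈-filter⁻ (λ j → adj G i j ≟ᵇ true) {xs = allFin n})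

record Homomorphism {m} (G : Graph n) (H : Graph m) : Set where
  constructor homomorphism
  field
    vertexMap    : Fin n → Fin m
    preservesAdj : ∀ {i j} → Adj G i j → Adj H (vertexMap i) (vertexMap j)

ThreeColourable-hom : ∀ {m} {G : Graph n} {H : Graph m} →
  Homomorphism G H → ThreeColourable H → ThreeColourable G
ThreeColourable-hom (homomorphism f hom) (colour , proper) =
  colour ∘ f , λ i j ij → proper (f i) (f j) (hom ij)

TriangleFree-hom : ∀ {m} {G : Graph n} {H : Graph m} →
  Homomorphism G H → TriangleFree H → TriangleFree G
TriangleFree-hom (homomorphism f hom) triangleFree a b c (ab , bc , ac) =
  triangleFree (f a) (f b) (f c) (hom ab , hom bc , hom ac)

walk? : (G : Graph n) → ∀ ℓ u v → Dec (Walk G u v ℓ)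
walk? G zero u v with u ≟ᶠ v
... | yes refl = yes here
... | no u≢v = no λ { here → u≢v refl }
walk? G (suc ℓ) u v =
  map′ (λ (_ , uw , wv) → step uw wv) (λ { (step uw wv) → _ , uw , wv })
       (any? λ w → (adj G u w ≟ᵇ true) ×-dec walk? G ℓ w v)

-- The first step of a walk from u back to u, followed by a walk to v.
walks-suc : (G : Graph n) → (∀ u v → Walk G u v (suc ℓ)) → ∀ u v → Walk G u v (suc (suc ℓ))
walks-suc G walks u v with walks u u
... | step uw _ = step uw (walks _ v)

walks-≥ : (G : Graph n) → (∀ u v → Walk G u v (suc ℓ)) → ℓ ≤′ k → ∀ u v → Walk G u v (suc k)
walks-≥ G walks ≤′-refl = walks
walks-≥ G walks (≤′-step ℓ≤′k) = walks-suc G (walks-≥ G walks ℓ≤′k)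

shift : Vec A k → A → Vec A k
shift [] _ = []
shift (_ ∷ w) x = w ∷ʳ x

unshift : A → Vec A k → Vec A k
unshift {k = zero} _ [] = []
unshift {k = suc k} y w = y ∷ init w

shift⇒unshift : ∀ (v : Vec A k) x {w} → shift v x ≡ w → ∃[ y ] v ≡ unshift y w
shift⇒unshift [] x refl = x , refl
shift⇒unshift (y ∷ v) x refl = y , cong (y ∷_) (sym (init-∷ʳ x v))

shiftIn : Vec A k → Vec A ℓ → Vec A k
shiftIn w [] = w
shiftIn w (x ∷ xs) = shiftIn (shift w x) xs

-- Stated on lists, since for vectors ys ++ zs and the shifted word have
-- lengths that agree only propositionally.
toList-shiftIn : (w : Vec A k) (xs : Vec A ℓ) (ys zs : List A) →
  length ys ≡ ℓ → toList w ≡ ys ++ zs → toList (shiftIn w xs) ≡ zs ++ toList xs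
toList-shiftIn w [] [] zs _ w≡zs = trans w≡zs (sym (++-identityʳ zs))
toList-shiftIn [] (x ∷ xs) (y ∷ ys) zs _ ()
toList-shiftIn (a ∷ w) (x ∷ xs) (y ∷ ys) zs |ys| w≡ys++zs = begin
  toList (shiftIn (w ∷ʳ x) xs)
    ≡⟨ toList-shiftIn (w ∷ʳ x) xs ys (zs ++ [ x ]) (suc-injective |ys|) w∷ʳx≡ ⟩
  (zs ++ [ x ]) ++ toList xs
    ≡⟨ ++-assoc zs [ x ] (toList xs) ⟩
  zs ++ x ∷ toList xs ∎
  where
  open ≡-Reasoning
  w∷ʳx≡ : toList (w ∷ʳ x) ≡ ys ++ (zs ++ [ x ])
  w∷ʳx≡ = begin
    toList (w ∷ʳ x)        ≡⟨ toList-∷ʳ x w ⟩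
    toList w ++ [ x ]      ≡⟨ cong (_++ [ x ]) (∷-injectiveʳ w≡ys++zs) ⟩
    (ys ++ zs) ++ [ x ]    ≡⟨ ++-assoc ys zs [ x ] ⟩
    ys ++ (zs ++ [ x ])    ∎

shiftIn-self : (w v : Vec A k) → shiftIn w v ≡ v
shiftIn-self w v = trans (sym (cast-is-id refl (shiftIn w v)))
  (toList-injective refl (shiftIn w v) v
    (toList-shiftIn w v (toList w) [] (length-toList w) (sym (++-identityʳ (toList w)))))

funToFin-cong : ∀ {m} {f g : Fin k → Fin m} → (∀ i → f i ≡ g i) → funToFin f ≡ funToFin g
funToFin-cong {zero} _ = refl
funToFin-cong {suc k} f≗g = cong₂ combine (f≗g zero) (funToFin-cong (f≗g ∘ suc))

Vec↔Fin^ : ∀ {d} → Vec (Fin d) k ↔ Fin (d ^ k)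
Vec↔Fin^ {k} {d} = mk↔ₛ′ (funToFin ∘ lookup) (tabulate ∘ finToFun)
  (λ i → trans (funToFin-cong {k} {d} (lookup∘tabulate (finToFun i))) (funToFin-finToFin {k} {d} i))
  (λ w → trans (tabulate-cong (finToFun-funToFin (lookup w))) (tabulate∘lookup w))

module Product {m} (H : Graph m) (d k : ℕ) where

  Word : Set
  Word = Vec (Fin d) k

  _↝_ : Word → Word → Set
  w ↝ w' = ∃[ x ] shift w x ≡ w'

  _↝?_ : ∀ w w' → Dec (w ↝ w')
  w ↝? w' = any? λ x → ≡-dec _≟ᶠ_ (shift w x) w'

  linked : Word → Word → Bool
  linked w w' = does (w ↝? w') ∨ does (w' ↝? w)

  wordNeighbours : Word → List Word
  wordNeighbours w = map (shift w) (allFin d) ++ map (λ y → unshift y w) (allFin d)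

  length-wordNeighbours : ∀ w → length (wordNeighbours w) ≡ d + d
  length-wordNeighbours w = begin
    length (map (shift w) (allFin d) ++ map (λ y → unshift y w) (allFin d))
      ≡⟨ length-++ (map (shift w) (allFin d)) ⟩
    length (map (shift w) (allFin d)) + length (map (λ y → unshift y w) (allFin d))
      ≡⟨ cong₂ _+_ (length-of (shift w)) (length-of (λ y → unshift y w)) ⟩
    d + d ∎
    where
    open ≡-Reasoning
    length-of : (f : Fin d → Word) → length (map f (allFin d)) ≡ d
    length-of f = trans (length-map f (allFin d)) (length-tabulate (λ x → x))

  linked⇒∈ : ∀ w w' → linked w w' ≡ true → w' ∈ wordNeighbours w
  linked⇒∈ w w' l with ∨-true⁻ {does (w ↝? w')} l
  ... | inj₁ w↝w' with does⇒ (w ↝? w') w↝w'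
  ...   | x , refl = ∈-++⁺ˡ (∈-map⁺ (shift w) (∈-allFin x))
  linked⇒∈ w w' l | inj₂ w'↝w with does⇒ (w' ↝? w) w'↝w
  ...   | x , shifted with shift⇒unshift w' x shifted
  ...     | y , refl = ∈-++⁺ʳ (map (shift w) (allFin d)) (∈-map⁺ (λ y → unshift y w) (∈-allFin y))

  linked-shift : ∀ w x → linked w (shift w x) ≡ true
  linked-shift w x rewrite dec-true (w ↝? shift w x) (x , refl) = refl

  Vertex : Set
  Vertex = Fin m × Word

  adjᵛ : Vertex → Vertex → Bool
  adjᵛ (c , w) (c' , w') = adj H c c' ∧ linked w w'

  adjᵛ-sym : ∀ s t → adjᵛ s t ≡ adjᵛ t s
  adjᵛ-sym (c , w) (c' , w') = cong₂ _∧_ (Graph.sym H c c') (∨-comm (does (w ↝? w')) _)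

  adjᵛ-irrefl : ∀ s → adjᵛ s s ≡ false
  adjᵛ-irrefl (c , w) = cong (_∧ linked w w) (irrefl H c)

  open Inverse (↔-trans (↔-refl ×-↔ Vec↔Fin^ {k} {d}) (↔-sym (*↔× {m} {d ^ k})))
    using (to; from; strictlyInverseˡ; strictlyInverseʳ)

  graph : Graph (m * d ^ k)
  graph = record
    { adj    = λ i j → adjᵛ (from i) (from j)
    ; sym    = λ i j → adjᵛ-sym (from i) (from j)
    ; irrefl = λ i → adjᵛ-irrefl (from i)
    }

  projection : Homomorphism graph H
  projection = homomorphism (proj₁ ∘ from) (proj₁ ∘ ∧-true⁻)

  maxDegree : ∀ {δ} → MaxDegreeAtMost H δ → MaxDegreeAtMost graph (δ * (d + d))
  maxDegree {δ} maxDegreeH i = begin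
    degree graph i
      ≤⟨ degree≤length graph i adj⇒∈ ⟩
    length (cartesianProductWith (curry to) (neighbours H c) (wordNeighbours w))
      ≡⟨ length-cartesianProductWith (curry to) (neighbours H c) (wordNeighbours w) ⟩
    degree H c * length (wordNeighbours w)
      ≡⟨ cong (degree H c *_) (length-wordNeighbours w) ⟩
    degree H c * (d + d)
      ≤⟨ *-monoˡ-≤ (d + d) (maxDegreeH c) ⟩
    δ * (d + d) ∎
    where
    open ≤-Reasoning
    c = proj₁ (from i)
    w = proj₂ (from i)
    adj⇒∈ : ∀ {j} → Adj graph i j →
      j ∈ cartesianProductWith (curry to) (neighbours H c) (wordNeighbours w)
    adj⇒∈ {j} ij with ∧-true⁻ ij
    ... | cc' , ww' = subst (_∈ _) (strictlyInverseˡ j)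
      (∈-cartesianProductWith⁺ (curry to) (∈-neighbours⁺ H cc') (linked⇒∈ w (proj₂ (from j)) ww'))

  adj-shift : ∀ {c c'} w x → Adj H c c' → Adj graph (to (c , w)) (to (c' , shift w x))
  adj-shift {c} {c'} w x cc' =
    subst₂ (λ s t → adjᵛ s t ≡ true) (sym (strictlyInverseʳ (c , w)))
      (sym (strictlyInverseʳ (c' , shift w x))) (cong₂ _∧_ cc' (linked-shift w x))

  lift-walk : ∀ {c c' ℓ} → Walk H c c' ℓ → (xs : Vec (Fin d) ℓ) (w : Word) →
    Walk graph (to (c , w)) (to (c' , shiftIn w xs)) ℓ
  lift-walk here [] w = here
  lift-walk (step cc₁ rest) (x ∷ xs) w = step (adj-shift w x cc₁) (lift-walk rest xs (shift w x))

  diameter : (∀ c c' → Walk H c c' k) → DiameterAtMost graph k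
  diameter walks u v = k , ≤-refl ,
    subst₂ (λ u v → Walk graph u v k) (strictlyInverseˡ u) (strictlyInverseˡ v)
      (subst (λ w → Walk graph (to (from u)) (to (proj₁ (from v) , w)) k)
             (shiftIn-self (proj₂ (from u)) (proj₂ (from v)))
             (lift-walk (walks _ _) (proj₂ (from v)) (proj₂ (from u))))

properColouring? : (G : Graph n) (colour : Fin n → Fin 3) →
  Dec (∀ i j → Adj G i j → colour i ≢ colour j)
properColouring? G colour =
  all? λ i → all? λ j → (adj G i j ≟ᵇ true) →-dec ¬? (colour i ≟ᶠ colour j)

triangleFree? : (G : Graph n) → Dec (TriangleFree G)
triangleFree? G = all? λ a → all? λ b → all? λ c →
  ¬? ((adj G a b ≟ᵇ true) ×-dec (adj G b c ≟ᵇ true) ×-dec (adj G a c ≟ᵇ true))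

maxDegreeAtMost? : (G : Graph n) → ∀ δ → Dec (MaxDegreeAtMost G δ)
maxDegreeAtMost? G δ = all? λ i → degree G i ≤? δ

allWalks? : (G : Graph n) → ∀ ℓ → Dec (∀ u v → Walk G u v ℓ)
allWalks? G ℓ = all? λ u → all? λ v → walk? G ℓ u v

completeGraph : ∀ n → Graph n
completeGraph n = record
  { adj    = λ i j → not (does (i ≟ᶠ j))
  ; sym    = λ i j → cong not (does-⇔ (mk⇔ sym sym) (i ≟ᶠ j) (j ≟ᶠ i))
  ; irrefl = λ i → cong not (dec-true (i ≟ᶠ i) refl)
  }

K₃ : Graph 3
K₃ = completeGraph 3

C₅ : Graph 5
C₅ = record
  { adj    = adjacent
  ; sym    = λ i j → ∨-comm (adjacent-succ i j) _
  ; irrefl = from-yes (all? λ i → adjacent i i ≟ᵇ false)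
  }
  where
  adjacent-succ : Fin 5 → Fin 5 → Bool
  adjacent-succ i j = does (toℕ j ≟ℕ suc (toℕ i) % 5)
  adjacent : Fin 5 → Fin 5 → Bool
  adjacent i j = adjacent-succ i j ∨ adjacent-succ j i

C₅-colour : Fin 5 → Fin 3
C₅-colour zero = zero
C₅-colour (suc zero) = suc zero
C₅-colour (suc (suc zero)) = zero
C₅-colour (suc (suc (suc zero))) = suc zero
C₅-colour (suc (suc (suc (suc zero)))) = suc (suc zero)

K₃-threeColourable : ThreeColourable K₃
K₃-threeColourable = (λ c → c) , from-yes (properColouring? K₃ λ c → c)

K₃-maxDegree : MaxDegreeAtMost K₃ 2
K₃-maxDegree = from-yes (maxDegreeAtMost? K₃ 2)

K₃-walks₂ : ∀ u v → Walk K₃ u v 2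
K₃-walks₂ = from-yes (allWalks? K₃ 2)

C₅-threeColourable : ThreeColourable C₅
C₅-threeColourable = C₅-colour , from-yes (properColouring? C₅ C₅-colour)

C₅-triangleFree : TriangleFree C₅
C₅-triangleFree = from-yes (triangleFree? C₅)

C₅-maxDegree : MaxDegreeAtMost C₅ 2
C₅-maxDegree = from-yes (maxDegreeAtMost? C₅ 2)

C₅-walks₄ : ∀ u v → Walk C₅ u v 4
C₅-walks₄ = from-yes (allWalks? C₅ 4)

2*[Δ/4+Δ/4]≤Δ : ∀ Δ → 2 * (Δ / 4 + Δ / 4) ≤ Δ
2*[Δ/4+Δ/4]≤Δ Δ = ≤-trans (≤-reflexive (2*[d+d]≡d*4 (Δ / 4))) (m/n*n≤m Δ 4)
  where
  2*[d+d]≡d*4 : ∀ d → 2 * (d + d) ≡ d * 4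
  2*[d+d]≡d*4 = solve-∀

mainTheorem18 : (Δ k : ℕ) → 4 ≤ Δ → 2 ≤ k →
    (Σ (Graph (3 * (Δ / 4) ^ k)) λ G →
       ThreeColourable G × MaxDegreeAtMost G Δ × DiameterAtMost G k)
    × (4 ≤ k → Σ (Graph (5 * (Δ / 4) ^ k)) λ G →
       ThreeColourable G × TriangleFree G × MaxDegreeAtMost G Δ × DiameterAtMost G k)
mainTheorem18 Δ (suc k) _ (s≤s 1≤k) =
    ( K.graph
    , ThreeColourable-hom K.projection K₃-threeColourable
    , (λ i → ≤-trans (K.maxDegree K₃-maxDegree i) (2*[Δ/4+Δ/4]≤Δ Δ))
    , K.diameter (walks-≥ K₃ K₃-walks₂ (≤⇒≤′ 1≤k)) )
  , λ { (s≤s 3≤k) →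
      ( C.graph
      , ThreeColourable-hom C.projection C₅-threeColourable
      , TriangleFree-hom C.projection C₅-triangleFree
      , (λ i → ≤-trans (C.maxDegree C₅-maxDegree i) (2*[Δ/4+Δ/4]≤Δ Δ))
      , C.diameter (walks-≥ C₅ C₅-walks₄ (≤⇒≤′ 3≤k)) ) }
  where
  module K = Product K₃ (Δ / 4) (suc k)
  module C = Product C₅ (Δ / 4) (suc k)
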